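{- Let $0\le k\le k+p<n$, let $A=a_1\cdots a_n$ be a binary string with $k\le w(A)\le k+p+1$, let $A^\infty=a_1a_2\cdots$ be generated from $A$ by the symmetric shift register with parameters $k,p,n$, and for $r\ge0$ let $A_r=a_{r+1}\cdots a_{r+n}$ and $w_r=w(A_r)-k$. Suppose $r\ge0$, $0<x\le n$, $w_r=p+1$, $w_{r+x}=0$ and $0<w_{r+i}<p+1$ for $1\le i<x$. Then: (a) $w_{r+i+1}=w_{r+i}-\overline{w}(a_{r+i+1})$ for $0\le i<x$; (b) $w_{r+i}=p+1-\overline{w}(a_{r+1}\cdots a_{r+i})$ for $1\le i\le x$; (c) $\overline{w}(a_{r+1}\cdots a_{r+x})=p+1$ and $0<\overline{w}(a_{r+1}\cdots a_{r+i})<p+1$ for $1\le i<x$; (d) $w(A_r)=k+p+1$, $A_r$ starts with 1, and $V(A_r)\in M_p^+$.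
   Context: $w(B)$ is the number of 1's of a binary string $B$; the positive weight is $\overline{w}(B)=(\text{number of 1's in }B)-(\text{number of 0's in }B)$. The symmetric shift register with parameters $k,p,n$ generates $A^\infty=a_1a_2\cdots$ from $A$ by: for $i\ge0$, $a_{n+i+1}=1-a_{i+1}$ if $k\le a_{i+2}+\cdots+a_{i+n}\le k+p$, and $a_{n+i+1}=a_{i+1}$ otherwise. Even vector representation: a finite binary string $B$ starting with 1 is written uniquely as $1_{v_1}0_{v_2}1_{v_3}\cdots1_{v_J}0_{v_{J+1}}$ with $J$ odd, $v_i\ge1$ for $i\le J$ and $v_{J+1}\ge0$ ($1_v,0_v$ denote $v$ consecutive 1's or 0's); $V(B)=(v_1,\dots,v_{J+1})$. $M$ is the set of such integer vectors. For $V\in M$, alternating parameters: $\rho_0=0$, $\rho_{i+1}=\rho_i+v_{i+1}$ for $i$ even, $\rho_{i+1}=\rho_i-v_{i+1}$ for $i$ odd. $M_p^+$ is the set of $V\in M$ for which there is an odd $t$, $1\le t\le J$, with $\rho_i>0$ for $1\le i\le t$ and $\rho_t\ge p+1$. -}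

module Defs where

open import Data.Bool using (Bool; true; false; not; if_then_else_; _∧_)
open import Data.Nat using (ℕ; zero; suc; _+_; _*_; _≤_; _<_; _≤ᵇ_; _≡ᵇ_)
open import Data.Integer as ℤ using (ℤ; +_; _-_)
open import Data.List using (List; []; _∷_; _++_; [_]; map; upTo; take; length)
open import Data.Product using (Σ; ∃; ∃-syntax; _×_)
open import Relation.Binary.PropositionalEquality using (_≡_)

w : List Bool → ℕ
w []           = 0
w (true  ∷ bs) = suc (w bs)
w (false ∷ bs) = w bs

w0 : List Bool → ℕ
w0 []           = 0
w0 (true  ∷ bs) = w0 bs
w0 (false ∷ bs) = suc (w0 bs)

pw : List Bool → ℤ
pw B = (+ w B) - (+ w0 B)

step : ℕ → ℕ → List Bool → List Bool
step k p []         = []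
step k p (b ∷ rest) =
  rest ++ [ (if (k ≤ᵇ w rest) ∧ (w rest ≤ᵇ k + p) then not b else b) ]

-- window k p A i = a_{i+1} ⋯ a_{i+n}   (n = length A)
window : ℕ → ℕ → List Bool → ℕ → List Bool
window k p A zero    = A
window k p A (suc i) = step k p (window k p A i)

-- the generated sequence A^∞, 1-indexed: seqA k p A i = a_i for i ≥ 1
-- (the value at index 0 is an unused dummy)
seqA : ℕ → ℕ → List Bool → ℕ → Bool
seqA k p A zero    = false
seqA k p A (suc i) with window k p A i
... | []    = false
... | b ∷ _ = b

seg : (ℕ → Bool) → ℕ → ℕ → List Bool
seg a r len = map (λ j → a (r + suc j)) (upTo len)

runsFrom : Bool → ℕ → List Bool → List ℕ
runsFrom b c []       = c ∷ []
runsFrom b c (x ∷ xs) with x | b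
... | true  | true  = runsFrom b (suc c) xs
... | false | false = runsFrom b (suc c) xs
... | _     | _     = c ∷ runsFrom x 1 xs

runs : List Bool → List ℕ
runs []       = []
runs (x ∷ xs) = runsFrom x 1 xs

oddᵇ : ℕ → Bool
oddᵇ zero    = false
oddᵇ (suc n) = not (oddᵇ n)

-- For B starting with 1: B = 1_{v1} 0_{v2} ⋯ 1_{vJ} 0_{v_{J+1}}, J odd.
-- If B ends in 1 the run list has odd length J and v_{J+1} = 0 is appended.
V : List Bool → List ℕ
V B = if oddᵇ (length (runs B)) then runs B ++ [ 0 ] else runs B

Odd : ℕ → Set
Odd J = ∃[ m ] J ≡ suc (2 * m)

-- i-th entry (1-indexed), 0 outside range
entry : List ℕ → ℕ → ℕ
entry []       _             = 0
entry (v ∷ vs) zero          = 0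
entry (v ∷ vs) (suc zero)    = v
entry (v ∷ vs) (suc (suc i)) = entry vs (suc i)

InM : List ℕ → Set
InM Vs = ∃[ J ] (length Vs ≡ suc J × Odd J × (∀ i → 1 ≤ i → i ≤ J → 1 ≤ entry Vs i))

altSum : List ℕ → ℤ
altSum []       = + 0
altSum (v ∷ vs) = (+ v) - altSum vs

ρ : List ℕ → ℕ → ℤ
ρ Vs i = altSum (take i Vs)

InMp+ : ℕ → List ℕ → Set
InMp+ p Vs = InM Vs × ∃[ J ] (length Vs ≡ suc J ×
  ∃[ t ] (Odd t × 1 ≤ t × t ≤ J ×
          (∀ i → 1 ≤ i → i ≤ t → + 0 ℤ.< ρ Vs i) ×
          + (suc p) ℤ.≤ ρ Vs t))

-- Between the full window A_r (excess p+1) and the first empty window A_{r+x} (excess 0),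
-- the tail of each window A_{r+i}, i < x, has weight in [k, k+p]; for A_r because its
-- first bit is 1, since a leaving 0 would keep the window full.  So the register appends
-- the complement of the leaving bit and the excess drops by that bit's positive weight:
-- it is p+1 minus the walk of a_{r+1} a_{r+2} ⋯, which therefore stays positive and
-- reaches p+1 exactly at step x.  The walk rises along runs of 1's and falls along runs
-- of 0's, so the ρ_i at the ends of runs are values of the walk before it reaches p+1;
-- the run of 1's on which it does, or the last one before it, supplies the odd index t
-- of M_p^+.

module Submission where

open import Defs
open import Data.Bool using (Bool; true; false; not; if_then_else_)
open import Data.Bool.Properties using (not-involutive; not-¬)
open import Data.Nat using (ℕ; zero; suc; _+_; _*_; _≤_; _<_; z≤n; s≤s; z<s)
import Data.Nat.Properties as ℕₚ
open import Data.Integer as ℤ using (ℤ; +_; _-_; +≤+; +<+)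
import Data.Integer.Properties as ℤₚ
open import Data.Integer.Tactic.RingSolver using (solve-∀)
open import Data.List using (List; []; _∷_; [_]; _++_; take; length; head; map; upTo; applyUpTo)
import Data.List.Properties as Listₚ
open import Data.List.Relation.Unary.All using (All; []; _∷_)
open import Data.Maybe using (just)
open import Data.Product using (_×_; _,_; proj₁; proj₂; ∃-syntax; uncurry)
open import Data.Sum using (inj₁; inj₂)
open import Function using (_∘_)
open import Relation.Nullary using (¬_; contradiction)
open import Relation.Nullary.Decidable using (dec-true; dec-false)
open import Relation.Binary.PropositionalEquality hiding ([_])
open ≡-Reasoning

w-++ : ∀ xs ys → w (xs ++ ys) ≡ w xs + w ys
w-++ []           ys = refl
w-++ (true  ∷ xs) ys = cong suc (w-++ xs ys)
w-++ (false ∷ xs) ys = w-++ xs ys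

w0-++ : ∀ xs ys → w0 (xs ++ ys) ≡ w0 xs + w0 ys
w0-++ []           ys = refl
w0-++ (true  ∷ xs) ys = w0-++ xs ys
w0-++ (false ∷ xs) ys = cong suc (w0-++ xs ys)

pw-++ : ∀ xs ys → pw (xs ++ ys) ≡ pw xs ℤ.+ pw ys
pw-++ xs ys = begin
  + w (xs ++ ys) - + w0 (xs ++ ys)
    ≡⟨ cong₂ (λ m n → + m - + n) (w-++ xs ys) (w0-++ xs ys) ⟩
  + (w xs + w ys) - + (w0 xs + w0 ys)
    ≡⟨ cong₂ _-_ (ℤₚ.pos-+ (w xs) (w ys)) (ℤₚ.pos-+ (w0 xs) (w0 ys)) ⟩
  (+ w xs ℤ.+ + w ys) - (+ w0 xs ℤ.+ + w0 ys)
    ≡⟨ [i+j]-[k+l]≡[i-k]+[j-l] (+ w xs) (+ w ys) (+ w0 xs) (+ w0 ys) ⟩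
  pw xs ℤ.+ pw ys ∎
  where
  [i+j]-[k+l]≡[i-k]+[j-l] : ∀ i j k l → (i ℤ.+ j) - (k ℤ.+ l) ≡ (i - k) ℤ.+ (j - l)
  [i+j]-[k+l]≡[i-k]+[j-l] = solve-∀

w-not : ∀ b → + w [ not b ] ≡ + w [ b ] - pw [ b ]
w-not true  = refl
w-not false = refl

j+[i-j]≡i : ∀ i j → j ℤ.+ (i - j) ≡ i
j+[i-j]≡i = solve-∀

0<i-j⇒j<i : ∀ {i j} → + 0 ℤ.< i - j → j ℤ.< i
0<i-j⇒j<i {i} {j} 0<i-j =
  subst₂ ℤ._<_ (ℤₚ.+-identityʳ j) (j+[i-j]≡i i j) (ℤₚ.+-monoʳ-< j 0<i-j)

i-j<i⇒0<j : ∀ {i j} → i - j ℤ.< i → + 0 ℤ.< j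
i-j<i⇒0<j {i} {j} i-j<i =
  ℤₚ.neg-cancel-< (subst₂ ℤ._<_ (i-j-i≡-j i j) (ℤₚ.+-inverseʳ i) (ℤₚ.+-monoˡ-< (ℤ.- i) i-j<i))
  where
  i-j-i≡-j : ∀ i j → (i - j) - i ≡ ℤ.- j
  i-j-i≡-j = solve-∀

[+m]-[+n]≡+o⇒m≡n+o : ∀ {m n o} → + m - + n ≡ + o → m ≡ n + o
[+m]-[+n]≡+o⇒m≡n+o {m} {n} {o} eq = ℤₚ.+-injective (begin
  + m                ≡⟨ sym (j+[i-j]≡i (+ m) (+ n)) ⟩
  + n ℤ.+ (+ m - + n) ≡⟨ cong (ℤ._+_ (+ n)) eq ⟩
  + (n + o)          ∎)

0<[+m]-[+n]⇒n<m : ∀ {m n} → + 0 ℤ.< + m - + n → n < m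
0<[+m]-[+n]⇒n<m = ℤₚ.drop‿+<+ ∘ 0<i-j⇒j<i

[+m]-[+n]<+o⇒m<n+o : ∀ {m n o} → + m - + n ℤ.< + o → m < n + o
[+m]-[+n]<+o⇒m<n+o {m} {n} m-n<o =
  ℤₚ.drop‿+<+ (subst (ℤ._< _) (j+[i-j]≡i (+ m) (+ n)) (ℤₚ.+-monoʳ-< (+ n) m-n<o))

take-++ˡ : ∀ {A : Set} n (xs ys : List A) → n ≤ length xs → take n (xs ++ ys) ≡ take n xs
take-++ˡ zero    xs       ys _         = refl
take-++ˡ (suc n) (x ∷ xs) ys (s≤s n≤) = cong (x ∷_) (take-++ˡ n xs ys n≤)

seg-suc : ∀ (a : ℕ → Bool) i m → seg a i (suc m) ≡ a (suc i) ∷ seg a (suc i) m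
seg-suc a i m = cong₂ _∷_ (cong a (ℕₚ.+-comm i 1)) (begin
  map f (applyUpTo suc m) ≡⟨ Listₚ.map-applyUpTo suc f m ⟩
  applyUpTo (f ∘ suc) m   ≡⟨ Listₚ.map-upTo (f ∘ suc) m ⟨
  map (f ∘ suc) (upTo m)  ≡⟨ Listₚ.map-cong (λ j → cong a (ℕₚ.+-suc i (suc j))) (upTo m) ⟩
  seg a (suc i) m         ∎)
  where
  f : ℕ → Bool
  f j = a (i + suc j)

seg-snoc : ∀ (a : ℕ → Bool) i m → seg a i (suc m) ≡ seg a i m ++ [ a (i + suc m) ]
seg-snoc a i m = trans (cong (map f) (sym (Listₚ.upTo-∷ʳ m))) (Listₚ.map-++ f (upTo m) [ m ])
  where
  f : ℕ → Bool
  f j = a (i + suc j)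

module _ (k p : ℕ) where

  step-in-range : ∀ b rest → k ≤ w rest → w rest ≤ k + p → step k p (b ∷ rest) ≡ rest ++ [ not b ]
  step-in-range b rest lo hi
    rewrite dec-true (k ℕₚ.≤? w rest) lo | dec-true (w rest ℕₚ.≤? k + p) hi = refl

  step-above-range : ∀ b rest → k + p < w rest → step k p (b ∷ rest) ≡ rest ++ [ b ]
  step-above-range b rest above
    rewrite dec-true (k ℕₚ.≤? w rest) (ℕₚ.≤-trans (ℕₚ.m≤m+n k p) (ℕₚ.<⇒≤ above))
          | dec-false (w rest ℕₚ.≤? k + p) (ℕₚ.<⇒≱ above) = refl

  excess-step : ∀ b rest → k ≤ w rest → w rest ≤ k + p →
    + w (step k p (b ∷ rest)) - + k ≡ (+ w (b ∷ rest) - + k) - pw [ b ]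
  excess-step b rest lo hi = begin
    + w (step k p (b ∷ rest)) - + k
      ≡⟨ cong (λ bs → + w bs - + k) (step-in-range b rest lo hi) ⟩
    + w (rest ++ [ not b ]) - + k
      ≡⟨ cong (λ m → + m - + k) (w-++ rest [ not b ]) ⟩
    + (w rest + w [ not b ]) - + k
      ≡⟨ cong (_- + k) (ℤₚ.pos-+ (w rest) (w [ not b ])) ⟩
    (+ w rest ℤ.+ + w [ not b ]) - + k
      ≡⟨ cong (λ z → (+ w rest ℤ.+ z) - + k) (w-not b) ⟩
    (+ w rest ℤ.+ (+ w [ b ] - pw [ b ])) - + k
      ≡⟨ regroup (+ w rest) (+ w [ b ]) (pw [ b ]) (+ k) ⟩
    ((+ w [ b ] ℤ.+ + w rest) - + k) - pw [ b ]
      ≡⟨ cong (λ z → (z - + k) - pw [ b ]) (ℤₚ.pos-+ (w [ b ]) (w rest)) ⟨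
    (+ (w [ b ] + w rest) - + k) - pw [ b ]
      ≡⟨ cong (λ m → (+ m - + k) - pw [ b ]) (w-++ [ b ] rest) ⟨
    (+ w (b ∷ rest) - + k) - pw [ b ] ∎
    where
    regroup : ∀ x y z u → (x ℤ.+ (y - z)) - u ≡ ((y ℤ.+ x) - u) - z
    regroup = solve-∀

  tail-in-range : ∀ b rest → k < w (b ∷ rest) → w (b ∷ rest) ≤ w [ b ] + (k + p) →
    k ≤ w rest × w rest ≤ k + p
  tail-in-range true  rest lo hi = ℕₚ.≤-pred lo , ℕₚ.≤-pred hi
  tail-in-range false rest lo hi = ℕₚ.<⇒≤ lo , hi

module _ (k p : ℕ) (A : List Bool) where

  private
    W : ℕ → List Bool
    W = window k p A

    a : ℕ → Bool
    a = seqA k p A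

  length-step : ∀ bs → length (step k p bs) ≡ length bs
  length-step []         = refl
  length-step (b ∷ rest) = trans (Listₚ.length-++ rest) (ℕₚ.+-comm (length rest) 1)

  length-window : ∀ i → length (W i) ≡ length A
  length-window zero    = refl
  length-window (suc i) = trans (length-step (W i)) (length-window i)

  seqA-window : ∀ {i b rest} → W i ≡ b ∷ rest → a (suc i) ≡ b
  seqA-window eq rewrite eq = refl

  take-window : ∀ m i → m ≤ length A → take m (W i) ≡ seg a i m
  take-window zero    i _   = refl
  take-window (suc m) i m<n with W i in eq | subst (suc m ≤_) (sym (length-window i)) m<n
  ... | b ∷ rest | s≤s m≤rest = begin
    b ∷ take m rest
      ≡⟨ cong₂ _∷_ (seqA-window {i} eq) (take-++ˡ m rest _ m≤rest) ⟨
    a (suc i) ∷ take m (step k p (b ∷ rest))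
      ≡⟨ cong (λ bs → a (suc i) ∷ take m (step k p bs)) eq ⟨
    a (suc i) ∷ take m (W (suc i))
      ≡⟨ cong (a (suc i) ∷_) (take-window m (suc i) (ℕₚ.<⇒≤ m<n)) ⟩
    a (suc i) ∷ seg a (suc i) m
      ≡⟨ seg-suc a i m ⟨
    seg a i (suc m) ∎

  seg-window : ∀ i → seg a i (length A) ≡ W i
  seg-window i = begin
    seg a i (length A)      ≡⟨ take-window (length A) i ℕₚ.≤-refl ⟨
    take (length A) (W i)   ≡⟨ Listₚ.take-all (length A) (W i) (ℕₚ.≤-reflexive (length-window i)) ⟩
    W i                     ∎

  excess-step-window : ∀ j → k < w (W j) → w (W j) ≤ w [ a (suc j) ] + (k + p) →
    + w (W (suc j)) - + k ≡ (+ w (W j) - + k) - pw [ a (suc j) ]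
  excess-step-window j lo hi with W j
  ... | b ∷ rest = uncurry (excess-step k p b rest) (tail-in-range k p b rest lo hi)

  full-window-starts-with-1 : ∀ j → w (W j) ≡ suc (k + p) → w (W (suc j)) < suc (k + p) →
    ∃[ rest ] W j ≡ true ∷ rest
  full-window-starts-with-1 j full not-full with W j
  ... | true  ∷ rest = rest , refl
  ... | false ∷ rest = contradiction stays-full (ℕₚ.<⇒≢ not-full)
    where
    stays-full : w (step k p (false ∷ rest)) ≡ suc (k + p)
    stays-full = begin
      w (step k p (false ∷ rest))
        ≡⟨ cong w (step-above-range k p false rest (ℕₚ.≤-reflexive (sym full))) ⟩
      w (rest ++ [ false ])       ≡⟨ w-++ rest [ false ] ⟩
      w rest + 0                  ≡⟨ ℕₚ.+-identityʳ (w rest) ⟩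
      w rest                      ≡⟨ full ⟩
      suc (k + p)                 ∎

Odd-suc-suc : ∀ {n} → Odd n → Odd (suc (suc n))
Odd-suc-suc (m , refl) = suc m , cong suc (sym (ℕₚ.*-suc 2 m))

oddᵇ⇒Odd : ∀ n → oddᵇ n ≡ true → Odd n
oddᵇ⇒Odd (suc zero)    _   = 0 , refl
oddᵇ⇒Odd (suc (suc n)) odd = Odd-suc-suc (oddᵇ⇒Odd n (trans (sym (not-involutive (oddᵇ n))) odd))

Odd⇒oddᵇ : ∀ {n} → Odd n → oddᵇ n ≡ true
Odd⇒oddᵇ (zero  , refl) = refl
Odd⇒oddᵇ (suc m , refl) =
  subst (λ n → oddᵇ (suc n) ≡ true) (sym (ℕₚ.*-suc 2 m))
    (trans (not-involutive (oddᵇ (suc (2 * m)))) (Odd⇒oddᵇ (m , refl)))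

Odd⇒¬Odd-suc : ∀ {n} → Odd n → ¬ Odd (suc n)
Odd⇒¬Odd-suc odd odd-suc = not-¬ refl (trans (Odd⇒oddᵇ odd) (sym (Odd⇒oddᵇ odd-suc)))

Odd-≤-suc⇒≤ : ∀ {t n} → Odd t → Odd n → t ≤ suc n → t ≤ n
Odd-≤-suc⇒≤ odd-t odd-n t≤1+n with ℕₚ.m≤n⇒m<n∨m≡n t≤1+n
... | inj₁ t<1+n = ℕₚ.≤-pred t<1+n
... | inj₂ refl  = contradiction odd-t (Odd⇒¬Odd-suc odd-n)

Odd⇒1≤ : ∀ {n} → Odd n → 1 ≤ n
Odd⇒1≤ (_ , refl) = s≤s z≤n

entry-++ˡ : ∀ xs ys i → 1 ≤ i → i ≤ length xs → entry (xs ++ ys) i ≡ entry xs i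
entry-++ˡ (v ∷ vs) ys (suc zero)    _ _        = refl
entry-++ˡ (v ∷ vs) ys (suc (suc i)) _ (s≤s i≤) = entry-++ˡ vs ys (suc i) (s≤s z≤n) i≤

All⇒1≤entry : ∀ {xs} → All (1 ≤_) xs → ∀ i → 1 ≤ i → i ≤ length xs → 1 ≤ entry xs i
All⇒1≤entry (1≤v ∷ _)  (suc zero)    _ _        = 1≤v
All⇒1≤entry (_ ∷ 1≤vs) (suc (suc i)) _ (s≤s i≤) = All⇒1≤entry 1≤vs (suc i) (s≤s z≤n) i≤

runsFrom-positive : ∀ b c xs → All (1 ≤_) (runsFrom b (suc c) xs)
runsFrom-positive b     c []           = s≤s z≤n ∷ []
runsFrom-positive true  c (true  ∷ xs) = runsFrom-positive true (suc c) xs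
runsFrom-positive true  c (false ∷ xs) = s≤s z≤n ∷ runsFrom-positive false 0 xs
runsFrom-positive false c (true  ∷ xs) = s≤s z≤n ∷ runsFrom-positive true 0 xs
runsFrom-positive false c (false ∷ xs) = runsFrom-positive false (suc c) xs

-- The conclusion is V B unfolded, for the run list R = runs B.
InMp+-pad : ∀ p R → All (1 ≤_) R → ∀ t → Odd t → t ≤ length R →
  (∀ i → 1 ≤ i → i ≤ t → + 0 ℤ.< ρ R i) → + suc p ℤ.≤ ρ R t →
  InMp+ p (if oddᵇ (length R) then R ++ [ 0 ] else R)
InMp+-pad p [] _ t odd-t t≤0 _ _ = contradiction (ℕₚ.≤-trans (Odd⇒1≤ odd-t) t≤0) λ ()
InMp+-pad p R@(v ∷ vs) pos t odd-t t≤R ρ>0 ρ≥ with oddᵇ (length R) in parity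
... | true =
  (length R , length-padded , oddᵇ⇒Odd (length R) parity ,
   λ i 1≤i i≤R → subst (1 ≤_) (sym (entry-++ˡ R [ 0 ] i 1≤i i≤R)) (All⇒1≤entry pos i 1≤i i≤R)) ,
  (length R , length-padded , t , odd-t , Odd⇒1≤ odd-t , t≤R ,
   (λ i 1≤i i≤t → subst (+ 0 ℤ.<_) (sym (ρ-padded i (ℕₚ.≤-trans i≤t t≤R))) (ρ>0 i 1≤i i≤t)) ,
   subst (+ suc p ℤ.≤_) (sym (ρ-padded t t≤R)) ρ≥)
  where
  length-padded : length (R ++ [ 0 ]) ≡ suc (length R)
  length-padded = trans (Listₚ.length-++ R) (ℕₚ.+-comm (length R) 1)

  ρ-padded : ∀ i → i ≤ length R → ρ (R ++ [ 0 ]) i ≡ ρ R i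
  ρ-padded i i≤R = cong altSum (take-++ˡ i R [ 0 ] i≤R)
... | false =
  (length vs , refl , odd-vs , λ i 1≤i i≤vs → All⇒1≤entry pos i 1≤i (ℕₚ.m≤n⇒m≤1+n i≤vs)) ,
  (length vs , refl , t , odd-t , Odd⇒1≤ odd-t , Odd-≤-suc⇒≤ odd-t odd-vs t≤R , ρ>0 , ρ≥)
  where
  odd-vs : Odd (length vs)
  odd-vs = oddᵇ⇒Odd (length vs) (trans (sym (not-involutive (oddᵇ (length vs)))) (cong not parity))

module _ (p : ℕ) where

  record Climbs (h : ℤ) (xs : List Bool) (x : ℕ) : Set where
    constructor climbs
    field
      positive : ∀ i → i < x → + 0 ℤ.< h ℤ.+ pw (take i xs)
      top      : + suc p ℤ.≤ h ℤ.+ pw (take x xs)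

  Climbs-∷ : ∀ {h b xs x} → Climbs h (b ∷ xs) (suc x) → Climbs (h ℤ.+ pw [ b ]) xs x
  Climbs-∷ {h} {b} {xs} {x} (climbs positive top) = climbs
    (λ i i<x → subst (+ 0 ℤ.<_) (shift i) (positive (suc i) (s≤s i<x)))
    (subst (+ suc p ℤ.≤_) (shift x) top)
    where
    shift : ∀ i → h ℤ.+ pw (b ∷ take i xs) ≡ (h ℤ.+ pw [ b ]) ℤ.+ pw (take i xs)
    shift i = trans (cong (ℤ._+_ h) (pw-++ [ b ] (take i xs))) (sym (ℤₚ.+-assoc h _ _))

  -- The conditions of M_p^+ for a run list R that follows height s (first run of 1's)
  -- or height u (first run of 0's, so ρ enters with the opposite sign).
  Peak₁ : ℤ → List ℕ → Set
  Peak₁ s R = ∃[ t ] (Odd t × t ≤ length R ×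
    (∀ i → 1 ≤ i → i ≤ t → + 0 ℤ.< s ℤ.+ ρ R i) × + suc p ℤ.≤ s ℤ.+ ρ R t)

  Peak₀ : ℤ → List ℕ → Set
  Peak₀ u R = ∃[ t ] (Odd (suc t) × t ≤ length R ×
    (∀ i → 1 ≤ i → i ≤ t → + 0 ℤ.< u - ρ R i) × + suc p ℤ.≤ u - ρ R t)

  peak-here₁ : ∀ s c R → + suc p ℤ.≤ s ℤ.+ + c ℤ.+ + 0 → Peak₁ s (c ∷ R)
  peak-here₁ s c R top = 1 , (0 , refl) , s≤s z≤n , positive , top′
    where
    top′ : + suc p ℤ.≤ s ℤ.+ (+ c - + 0)
    top′ = subst (+ suc p ℤ.≤_) (ℤₚ.+-assoc s (+ c) (+ 0)) top

    positive : ∀ i → 1 ≤ i → i ≤ 1 → + 0 ℤ.< s ℤ.+ ρ (c ∷ R) i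
    positive (suc zero)    _ _           = ℤₚ.<-≤-trans (+<+ z<s) top′
    positive (suc (suc _)) _ (s≤s ())

  peak-here₀ : ∀ u c R → + suc p ℤ.≤ u - + c ℤ.+ + 0 → Peak₀ u R
  peak-here₀ u c R top =
    0 , (0 , refl) , z≤n , (λ _ 1≤i i≤0 → contradiction (ℕₚ.≤-trans 1≤i i≤0) λ ()) ,
    ℤₚ.≤-trans top (ℤₚ.+-monoˡ-≤ (+ 0) (ℤₚ.i-j≤i u (+ c)))

  climb₁ : ∀ s c xs x → Climbs (s ℤ.+ + c) xs x → Peak₁ s (runsFrom true c xs)
  climb₀ : ∀ u c xs x → Climbs (u - + c) xs x → Peak₀ u (runsFrom false c xs)

  climb₁ s c []           zero    (climbs _ top) = peak-here₁ s c [] top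
  climb₁ s c []           (suc x) (climbs _ top) = peak-here₁ s c [] top
  climb₁ s c (false ∷ xs) zero    (climbs _ top) = peak-here₁ s c _ top
  climb₁ s c (true  ∷ xs) zero    (climbs _ top) =
    climb₁ s (suc c) xs zero (climbs (λ _ ()) (ℤₚ.≤-trans top higher))
    where
    higher : s ℤ.+ + c ℤ.+ + 0 ℤ.≤ s ℤ.+ + suc c ℤ.+ + 0
    higher = ℤₚ.+-monoˡ-≤ (+ 0) (ℤₚ.+-monoʳ-≤ s (+≤+ (ℕₚ.n≤1+n c)))
  climb₁ s c (true  ∷ xs) (suc x) h =
    climb₁ s (suc c) xs x (subst (λ h → Climbs h xs x) (i+j+1≡i+[1+j] s (+ c)) (Climbs-∷ h))
    where
    i+j+1≡i+[1+j] : ∀ i j → i ℤ.+ j ℤ.+ + 1 ≡ i ℤ.+ (+ 1 ℤ.+ j)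
    i+j+1≡i+[1+j] = solve-∀
  climb₁ s c (false ∷ xs) (suc x) h with climb₀ (s ℤ.+ + c) 1 xs x (Climbs-∷ h)
  ... | t , odd , t≤ , positive , top =
    suc t , odd , s≤s t≤ , positive′ , subst (+ suc p ℤ.≤_) (ℤₚ.+-assoc s (+ c) _) top
    where
    positive′ : ∀ i → 1 ≤ i → i ≤ suc t → + 0 ℤ.< s ℤ.+ ρ (c ∷ runsFrom false 1 xs) i
    positive′ (suc zero)    _ _        = subst (+ 0 ℤ.<_) (ℤₚ.+-assoc s (+ c) _) (Climbs.positive h 0 z<s)
    positive′ (suc (suc i)) _ (s≤s i≤) =
      subst (+ 0 ℤ.<_) (ℤₚ.+-assoc s (+ c) _) (positive (suc i) (s≤s z≤n) i≤)

  climb₀ u c xs           zero    (climbs _ top) = peak-here₀ u c _ top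
  climb₀ u c []           (suc x) (climbs _ top) = peak-here₀ u c _ top
  climb₀ u c (false ∷ xs) (suc x) h =
    climb₀ u (suc c) xs x (subst (λ h → Climbs h xs x) (i-j-1≡i-[1+j] u (+ c)) (Climbs-∷ h))
    where
    i-j-1≡i-[1+j] : ∀ i j → i - j - + 1 ≡ i - (+ 1 ℤ.+ j)
    i-j-1≡i-[1+j] = solve-∀
  climb₀ u c (true  ∷ xs) (suc x) h with climb₁ (u - + c) 1 xs x (Climbs-∷ h)
  ... | t , odd , t≤ , positive , top =
    suc t , Odd-suc-suc odd , s≤s t≤ , positive′ , subst (+ suc p ℤ.≤_) (i-j+k≡i-[j-k] u (+ c) _) top
    where
    i-j+k≡i-[j-k] : ∀ i j k → i - j ℤ.+ k ≡ i - (j - k)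
    i-j+k≡i-[j-k] = solve-∀

    positive′ : ∀ i → 1 ≤ i → i ≤ suc t → + 0 ℤ.< u - ρ (c ∷ runsFrom true 1 xs) i
    positive′ (suc zero)    _ _        = subst (+ 0 ℤ.<_) (i-j+k≡i-[j-k] u (+ c) _) (Climbs.positive h 0 z<s)
    positive′ (suc (suc i)) _ (s≤s i≤) =
      subst (+ 0 ℤ.<_) (i-j+k≡i-[j-k] u (+ c) _) (positive (suc i) (s≤s z≤n) i≤)

  climbing⇒InMp+ : ∀ xs x → (∀ i → 1 ≤ i → i < x → + 0 ℤ.< pw (take i (true ∷ xs))) →
    + suc p ℤ.≤ pw (take x (true ∷ xs)) → InMp+ p (V (true ∷ xs))
  climbing⇒InMp+ xs zero    _        (+≤+ ())
  climbing⇒InMp+ xs (suc x) positive top with climb₁ (+ 0) 1 xs x walk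
    where
    walk : Climbs (+ 1) xs x
    walk = climbs
      (λ i i<x → subst (+ 0 ℤ.<_) (pw-++ [ true ] (take i xs)) (positive (suc i) (s≤s z≤n) (s≤s i<x)))
      (subst (+ suc p ℤ.≤_) (pw-++ [ true ] (take x xs)) top)
  ... | t , odd , t≤ , ρ>0 , ρ≥ =
    InMp+-pad p (runsFrom true 1 xs) (runsFrom-positive true 0 xs) t odd t≤
      (λ i 1≤i i≤t → subst (+ 0 ℤ.<_) (ℤₚ.+-identityˡ _) (ρ>0 i 1≤i i≤t))
      (subst (+ suc p ℤ.≤_) (ℤₚ.+-identityˡ _) ρ≥)

excess : ℕ → ℕ → List Bool → ℕ → ℤ
excess k p A j = + w (seg (seqA k p A) j (length A)) - + k

module FullToEmpty
  (k p : ℕ) (A : List Bool) (r x : ℕ) (0<x : 0 < x) (x≤n : x ≤ length A)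
  (full   : excess k p A r ≡ + (p + 1))
  (empty  : excess k p A (r + x) ≡ + 0)
  (inside : ∀ i → 1 ≤ i → i < x →
    (+ 0 ℤ.< excess k p A (r + i)) × (excess k p A (r + i) ℤ.< + (p + 1)))
  where

  private
    n : ℕ
    n = length A

    a : ℕ → Bool
    a = seqA k p A

    W : ℕ → List Bool
    W = window k p A

    E : ℕ → ℤ
    E = excess k p A

    k+[p+1]≡1+[k+p] : k + (p + 1) ≡ suc (k + p)
    k+[p+1]≡1+[k+p] = trans (cong (_+_ k) (ℕₚ.+-comm p 1)) (ℕₚ.+-suc k p)

  excess-window : ∀ j → E j ≡ + w (W j) - + k
  excess-window j = cong (λ bs → + w bs - + k) (seg-window k p A j)

  full-weight : w (W r) ≡ suc (k + p)
  full-weight =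
    trans ([+m]-[+n]≡+o⇒m≡n+o {n = k} (trans (sym (excess-window r)) full)) k+[p+1]≡1+[k+p]

  empty-weight : w (W (r + x)) ≡ k
  empty-weight =
    trans ([+m]-[+n]≡+o⇒m≡n+o {n = k} (trans (sym (excess-window (r + x))) empty)) (ℕₚ.+-identityʳ k)

  inside-weight : ∀ i → 1 ≤ i → i < x → k < w (W (r + i)) × w (W (r + i)) ≤ k + p
  inside-weight i 1≤i i<x with inside i 1≤i i<x
  ... | lo , hi rewrite excess-window (r + i) =
    0<[+m]-[+n]⇒n<m {n = k} lo ,
    ℕₚ.≤-pred (subst (w (W (r + i)) <_) k+[p+1]≡1+[k+p] ([+m]-[+n]<+o⇒m<n+o {n = k} hi))

  below-full : ∀ i → 1 ≤ i → i ≤ x → w (W (r + i)) < suc (k + p)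
  below-full i 1≤i i≤x with ℕₚ.m≤n⇒m<n∨m≡n i≤x
  ... | inj₁ i<x = s≤s (proj₂ (inside-weight i 1≤i i<x))
  ... | inj₂ refl rewrite empty-weight = s≤s (ℕₚ.m≤m+n k p)

  starts-with-1 : ∃[ rest ] W r ≡ true ∷ rest
  starts-with-1 = full-window-starts-with-1 k p A r full-weight
    (subst (λ j → w (W j) < suc (k + p)) (ℕₚ.+-comm r 1) (below-full 1 ℕₚ.≤-refl 0<x))

  private
    tail₀ : List Bool
    tail₀ = proj₁ starts-with-1

    window-r : W r ≡ true ∷ tail₀
    window-r = proj₂ starts-with-1

  step-range : ∀ i → i < x → k < w (W (r + i)) × w (W (r + i)) ≤ w [ a (suc (r + i)) ] + (k + p)
  step-range zero _ rewrite ℕₚ.+-identityʳ r =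
    subst (k <_) (sym full-weight) (s≤s (ℕₚ.m≤m+n k p)) ,
    subst (λ b → w (W r) ≤ w [ b ] + (k + p)) (sym (seqA-window k p A {r} window-r))
      (ℕₚ.≤-reflexive full-weight)
  step-range (suc i) i<x with inside-weight (suc i) (s≤s z≤n) i<x
  ... | lo , hi = lo , ℕₚ.≤-trans hi (ℕₚ.m≤n+m (k + p) (w [ a (suc (r + suc i)) ]))

  excess-next : ∀ i → i < x → E (r + i + 1) ≡ E (r + i) - pw [ a (r + i + 1) ]
  excess-next i i<x rewrite ℕₚ.+-comm (r + i) 1 = begin
    E (suc (r + i))
      ≡⟨ excess-window (suc (r + i)) ⟩
    + w (W (suc (r + i))) - + k
      ≡⟨ uncurry (excess-step-window k p A (r + i)) (step-range i i<x) ⟩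
    (+ w (W (r + i)) - + k) - pw [ a (suc (r + i)) ]
      ≡⟨ cong (_- pw [ a (suc (r + i)) ]) (excess-window (r + i)) ⟨
    E (r + i) - pw [ a (suc (r + i)) ] ∎

  excess-prefix : ∀ i → i ≤ x → E (r + i) ≡ + (p + 1) - pw (seg a r i)
  excess-prefix zero _ = begin
    E (r + 0)         ≡⟨ cong E (ℕₚ.+-identityʳ r) ⟩
    E r               ≡⟨ full ⟩
    + (p + 1)         ≡⟨ ℤₚ.+-identityʳ (+ (p + 1)) ⟨
    + (p + 1) - + 0   ∎
  excess-prefix (suc i) i<x = begin
    E (r + suc i)
      ≡⟨ cong E next ⟨
    E (r + i + 1)
      ≡⟨ excess-next i i<x ⟩
    E (r + i) - pw [ a (r + i + 1) ]
      ≡⟨ cong (_- pw [ a (r + i + 1) ]) (excess-prefix i (ℕₚ.<⇒≤ i<x)) ⟩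
    + (p + 1) - pw (seg a r i) - pw [ a (r + i + 1) ]
      ≡⟨ i-j-k≡i-[j+k] (+ (p + 1)) (pw (seg a r i)) (pw [ a (r + i + 1) ]) ⟩
    + (p + 1) - (pw (seg a r i) ℤ.+ pw [ a (r + i + 1) ])
      ≡⟨ cong (λ z → + (p + 1) - z) (pw-++ (seg a r i) [ a (r + i + 1) ]) ⟨
    + (p + 1) - pw (seg a r i ++ [ a (r + i + 1) ])
      ≡⟨ cong (λ j → + (p + 1) - pw (seg a r i ++ [ a j ])) next ⟩
    + (p + 1) - pw (seg a r i ++ [ a (r + suc i) ])
      ≡⟨ cong (λ bs → + (p + 1) - pw bs) (seg-snoc a r i) ⟨
    + (p + 1) - pw (seg a r (suc i)) ∎
    where
    next : r + i + 1 ≡ r + suc i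
    next = trans (ℕₚ.+-assoc r i 1) (cong (_+_ r) (ℕₚ.+-comm i 1))

    i-j-k≡i-[j+k] : ∀ i j k → i - j - k ≡ i - (j ℤ.+ k)
    i-j-k≡i-[j+k] = solve-∀

  prefix-reaches : pw (seg a r x) ≡ + (p + 1)
  prefix-reaches = sym (ℤₚ.i-j≡0⇒i≡j _ _ (trans (sym (excess-prefix x ℕₚ.≤-refl)) empty))

  prefix-between : ∀ i → 1 ≤ i → i < x → (+ 0 ℤ.< pw (seg a r i)) × (pw (seg a r i) ℤ.< + (p + 1))
  prefix-between i 1≤i i<x with inside i 1≤i i<x
  ... | lo , hi rewrite excess-prefix i (ℕₚ.<⇒≤ i<x) = i-j<i⇒0<j hi , 0<i-j⇒j<i lo

  seg-weight : w (seg a r n) ≡ k + p + 1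
  seg-weight = trans (cong w (seg-window k p A r)) (trans full-weight (ℕₚ.+-comm 1 (k + p)))

  seg-head : head (seg a r n) ≡ just true
  seg-head = cong head (trans (seg-window k p A r) window-r)

  seg-V∈Mp+ : InMp+ p (V (seg a r n))
  seg-V∈Mp+ = subst (InMp+ p ∘ V) (sym (trans (seg-window k p A r) window-r))
    (climbing⇒InMp+ p tail₀ x positive top)
    where
    prefix : ∀ i → i ≤ x → seg a r i ≡ take i (true ∷ tail₀)
    prefix i i≤x = trans (sym (take-window k p A i r (ℕₚ.≤-trans i≤x x≤n))) (cong (take i) window-r)

    positive : ∀ i → 1 ≤ i → i < x → + 0 ℤ.< pw (take i (true ∷ tail₀))
    positive i 1≤i i<x =
      subst (λ bs → + 0 ℤ.< pw bs) (prefix i (ℕₚ.<⇒≤ i<x)) (proj₁ (prefix-between i 1≤i i<x))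

    top : + suc p ℤ.≤ pw (take x (true ∷ tail₀))
    top = subst₂ ℤ._≤_ (cong +_ (ℕₚ.+-comm p 1)) (cong pw (prefix x ℕₚ.≤-refl))
      (ℤₚ.≤-reflexive (sym prefix-reaches))

proposition44p2 : (k p n : ℕ) → k + p < n →
    (A : List Bool) → length A ≡ n → k ≤ w A → w A ≤ k + p + 1 →
    (r x : ℕ) → 0 < x → x ≤ n →
    (+ w (seg (seqA k p A) r n)) - (+ k) ≡ + (p + 1) →
    (+ w (seg (seqA k p A) (r + x) n)) - (+ k) ≡ + 0 →
    (∀ i → 1 ≤ i → i < x →
      (+ 0 ℤ.< (+ w (seg (seqA k p A) (r + i) n)) - (+ k)) ×
      ((+ w (seg (seqA k p A) (r + i) n)) - (+ k) ℤ.< + (p + 1))) →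
    (∀ i → i < x →
      (+ w (seg (seqA k p A) (r + i + 1) n)) - (+ k)
        ≡ ((+ w (seg (seqA k p A) (r + i) n)) - (+ k)) - pw [ seqA k p A (r + i + 1) ]) ×
    (∀ i → 1 ≤ i → i ≤ x →
      (+ w (seg (seqA k p A) (r + i) n)) - (+ k)
        ≡ + (p + 1) - pw (seg (seqA k p A) r i)) ×
    (pw (seg (seqA k p A) r x) ≡ + (p + 1)) ×
    (∀ i → 1 ≤ i → i < x →
      (+ 0 ℤ.< pw (seg (seqA k p A) r i)) × (pw (seg (seqA k p A) r i) ℤ.< + (p + 1))) ×
    (w (seg (seqA k p A) r n) ≡ k + p + 1) ×
    (head (seg (seqA k p A) r n) ≡ just true) ×
    InMp+ p (V (seg (seqA k p A) r n))
proposition44p2 k p .(length A) _ A refl _ _ r x 0<x x≤n full empty inside =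
  excess-next , (λ i _ → excess-prefix i) , prefix-reaches , prefix-between ,
  seg-weight , seg-head , seg-V∈Mp+
  where open FullToEmpty k p A r x 0<x x≤n full empty inside
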